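{- Let $k\geq 3$ and $t\geq 1$ be integers and let $C$ be the chain gadget with parameters $k$ and $t$. Let $h$ be the colouring of $C$ given by $h(a_{2i-1,j})=j$ for $1\leq i\leq t$, $1\leq j\leq k-1$, and $h(b_{2i,j})=0$ for $1\leq i\leq t$, $1\leq j\leq k$. Then $h$ is a $k$-acyclic colouring of $C$, and every $k$-acyclic colouring $f$ of $C$ is the same as $h$ up to colour swaps and automorphisms, i.e. there exist a permutation $\sigma$ of $\{0,\dots,k-1\}$ and an automorphism $\psi$ of $C$ with $f(\psi(v))=\sigma(h(v))$ for all $v\in V(C)$. In particular, for every $k$-acyclic colouring $f$ of $C$: (i) there is a colour $c_1$ such that every terminal $v'_1,\dots,v'_t$ gets colour $c_1$; and (ii) for every colour $c_2\neq c_1$ and every pair of terminals $x,y$, there is an $x,y$-path in $C$ all of whose vertices are coloured $c_1$ or $c_2$.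
   Context: All graphs are finite, simple and undirected. A $k$-acyclic colouring of $G$ is a function $f\colon V(G)\to\{0,\dots,k-1\}$ with $f(u)\neq f(v)$ for every edge $uv$ such that no cycle is bicoloured by $f$. The chain gadget with parameters $k$ and $t$ is the graph $C$ whose vertices are arranged in levels $1,\dots,2t$: for each $i\in\{1,\dots,t\}$, Level $2i-1$ consists of vertices $a_{2i-1,1},\dots,a_{2i-1,k-1}$ and Level $2i$ consists of vertices $b_{2i,1},\dots,b_{2i,k}$. Edges: for each $i\in\{1,\dots,t\}$, every vertex of Level $2i-1$ is adjacent to every vertex of Level $2i$ (so these two levels induce $K_{k-1,k}$); for each $i\in\{1,\dots,t-1\}$ and each $j\in\{1,\dots,k-1\}$, $b_{2i,j}$ is adjacent to $a_{2i+1,j}$; there are no other edges. The terminals of $C$ are $v'_i:=b_{2i,k}$ for $i=1,\dots,t$. Colourings $f_1,f_2$ of a graph $G$ are the same up to colour swaps and automorphisms if $f_2(\psi(v))=\sigma(f_1(v))$ for all $v$, for some colour permutation $\sigma$ and automorphism $\psi$ of $G$. -}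

module Defs where

open import Data.Nat using (ℕ; zero; suc; _≤_)
open import Data.Fin using (Fin; toℕ; inject₁; fromℕ)
open import Data.Product using (_×_; Σ; ∃; _,_)
open import Data.Sum using (_⊎_)
open import Data.Empty using (⊥)
open import Data.Maybe using (just)
open import Data.List using (List; []; _∷_; length; head; last; _∷ʳ_)
open import Data.List.Relation.Unary.All using (All)
open import Data.List.Relation.Unary.Linked using (Linked)
open import Data.List.Relation.Unary.Unique.Propositional using (Unique)
open import Relation.Binary.PropositionalEquality using (_≡_; _≢_)
open import Relation.Nullary using (¬_)
open import Function.Bundles using (Inverse; _↔_)
open import Data.Fin.Permutation using (Permutation′; _⟨$⟩ʳ_)

-- Throughout, k = suc m is the number of colours (so k - 1 = m),
-- and t is the number of pairs of levels.
-- Colours are Fin k = Fin (suc m), i.e. {0,…,k-1}.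

-- Vertices of the chain gadget with parameters k = suc m and t.
--   a i j  (i : Fin t, j : Fin m)      stands for a_{2(i+1)-1, j+1}
--   b i j  (i : Fin t, j : Fin (suc m)) stands for b_{2(i+1), j+1}
data V (m t : ℕ) : Set where
  a : Fin t → Fin m → V m t
  b : Fin t → Fin (suc m) → V m t

data E {m t : ℕ} : V m t → V m t → Set where
  full : (i : Fin t) (j : Fin m) (j' : Fin (suc m)) → E (a i j) (b i j')
  link : (i i' : Fin t) → toℕ i' ≡ suc (toℕ i) → (j : Fin m) →
         E (b i (inject₁ j)) (a i' j)

Adj : {m t : ℕ} → V m t → V m t → Set
Adj u v = E u v ⊎ E v u

terminal : {m t : ℕ} → Fin t → V m t
terminal {m} i = b i (fromℕ m)

h : {m t : ℕ} → V m t → Fin (suc m)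
h (a i j) = Fin.suc j
h (b i j) = Fin.zero

IsCycle : {m t : ℕ} → List (V m t) → Set
IsCycle [] = ⊥
IsCycle (v ∷ vs) = (3 ≤ length (v ∷ vs)) × Unique (v ∷ vs) × Linked Adj ((v ∷ vs) ∷ʳ v)

IsPath : {m t : ℕ} → V m t → V m t → List (V m t) → Set
IsPath x y ps = (head ps ≡ just x) × (last ps ≡ just y) × Unique ps × Linked Adj ps

Bicoloured : {m t : ℕ} → (V m t → Fin (suc m)) → List (V m t) → Set
Bicoloured f vs = Σ (Fin _) λ c₁ → Σ (Fin _) λ c₂ → All (λ v → f v ≡ c₁ ⊎ f v ≡ c₂) vs

IsAcyclicColouring : {m t : ℕ} → (V m t → Fin (suc m)) → Set
IsAcyclicColouring {m} {t} f =
  (∀ u v → Adj u v → f u ≢ f v) ×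
  (∀ (vs : List (V m t)) → IsCycle vs → ¬ Bicoloured f vs)

IsAutomorphism : {m t : ℕ} → (V m t ↔ V m t) → Set
IsAutomorphism {m} {t} ψ =
  ∀ (u v : V m t) → (Adj u v → Adj (to u) (to v)) × (Adj (to u) (to v) → Adj u v)
  where open Inverse ψ

-- Rank the vertices level by level, a_{i,·} below b_{i,·} below a_{i+1,·}. Every edge joins
-- different ranks, and inside an h-bicoloured subgraph every vertex has at most one lower
-- neighbour (b-vertices have colour 0, so only one a-colour can occur). A non-backtracking walk
-- that has ascended can therefore never descend again, so it cannot close up: h is acyclic.
--
-- For an arbitrary acyclic colouring f only properness and the absence of bicoloured 4-cycles
-- a b a' b' inside a level are used. They force the k - 1 a-vertices of each level to get distinct
-- colours, so all k b-vertices of the level get the one remaining colour; the link edges carry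
-- this colour c₁ from each level to the next. Hence each level's a-vertices carry the colours
-- other than c₁ bijectively. Permuting every level so that its a-colours match those of level 1,
-- and each b-level consistently with the a-level it links to, is an automorphism ψ with
-- f ∘ ψ = σ ∘ h. A c₁/c₂ path between terminals zigzags through the c₂-coloured a-vertex of
-- each level in between.

module Submission where

open import Defs
open import Data.Nat using (ℕ; zero; suc; _+_; _≤_; _<_; s≤s; z≤n)
open import Data.Nat.Properties
  using (<-irrefl; <-asym; <-trans; ≤-reflexive; ≤-trans; ≤-total; n<1+n; m≤m+n; +-suc; +-identityʳ)
  renaming (m≤n⇒∃[o]m+o≡n to ≤⇒∃+)
import Data.Nat.Properties as ℕ
open import Data.Fin using (Fin; toℕ; inject₁; fromℕ; punchIn; punchOut)
import Data.Fin as Fin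
open import Data.Fin.Properties
  using (_≟_; any?; pigeonhole; punchOut-injective; <⇒≢; toℕ-injective; toℕ-inject₁; fromℕ≢inject₁)
  renaming (toℕ≤pred[n] to toℕ≤pred)
import Data.Fin.Properties as Finₚ
open import Data.Fin.Induction using (<-weakInduction)
open import Data.Fin.Permutation
  using (Permutation′; _⟨$⟩ʳ_; _⟨$⟩ˡ_; permutation; inverseˡ; inverseʳ; insert; insert-punchIn)
open import Data.Vec.Functional as Vec using ()
open import Data.Product using (_×_; Σ; ∃; ∃₂; _,_; proj₁; proj₂)
open import Data.Sum using (_⊎_; inj₁; inj₂)
import Data.Sum as Sum
open import Data.Empty using (⊥; ⊥-elim)
open import Data.Unit using (⊤; tt)
open import Data.Maybe using (just)
open import Data.Maybe.Relation.Binary.Connected using (Connected)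
import Data.Maybe.Relation.Binary.Connected as Connected
open import Data.List using (List; []; _∷_; _++_; _∷ʳ_; [_]; length; head; last; reverse)
open import Data.List.Properties using (++-assoc; unfold-reverse; reverse-involutive)
open import Data.List.Relation.Unary.All using (All; []; _∷_)
import Data.List.Relation.Unary.All as All
open import Data.List.Relation.Unary.All.Properties using (++⁻ʳ; ∷ʳ⁺)
open import Data.List.Relation.Unary.AllPairs using ([]; _∷_)
import Data.List.Relation.Unary.AllPairs as AllPairs
open import Data.List.Relation.Unary.Linked using (Linked; []; [-]; _∷_)
import Data.List.Relation.Unary.Linked as Linked
open import Data.List.Relation.Unary.Linked.Properties using (Linked⇒AllPairs; ++⁺)
open import Data.List.Relation.Unary.Unique.Propositional using (Unique)
open import Data.List.Relation.Binary.Permutation.Setoid using (↭-sym)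
import Data.List.Relation.Binary.Permutation.Setoid.Properties as ↭
open import Level using (0ℓ)
open import Relation.Binary.Core using (Rel)
open import Relation.Binary.Definitions using (Symmetric; Transitive; Irreflexive)
open import Relation.Binary.PropositionalEquality
  using (_≡_; _≢_; refl; sym; trans; cong; subst; subst₂; setoid; ≢-sym; module ≡-Reasoning)
open import Relation.Nullary using (yes; no)
open import Function using (_∘_)
open import Function.Bundles using (Inverse; _↔_; mk↔ₛ′)
open import Function.Definitions using (Injective)

private variable
  X : Set

last-∷ʳ : ∀ (xs : List X) x → last (xs ∷ʳ x) ≡ just x
last-∷ʳ []           x = refl
last-∷ʳ (_ ∷ [])     x = refl
last-∷ʳ (_ ∷ y ∷ xs) x = last-∷ʳ (y ∷ xs) x

last-reverse : ∀ (xs : List X) → last (reverse xs) ≡ head xs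
last-reverse []       = refl
last-reverse (x ∷ xs) = trans (cong last (unfold-reverse x xs)) (last-∷ʳ (reverse xs) x)

head-reverse : ∀ (xs : List X) → head (reverse xs) ≡ last xs
head-reverse xs = trans (sym (last-reverse (reverse xs))) (cong last (reverse-involutive xs))

All-reverse : ∀ {P : X → Set} {xs} → All P xs → All P (reverse xs)
All-reverse {P = P} {xs} =
  ↭.All-resp-↭ (setoid _) (subst P) (↭-sym (setoid _) (↭.↭-reverse (setoid _) xs))

Unique-reverse : ∀ {xs : List X} → Unique xs → Unique (reverse xs)
Unique-reverse {xs = xs} =
  ↭.Unique-resp-↭ (setoid _) (↭-sym (setoid _) (↭.↭-reverse (setoid _) xs))

Linked-reverse : ∀ {R : Rel X 0ℓ} → Symmetric R → ∀ {xs} → Linked R xs → Linked R (reverse xs)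
Linked-reverse R-sym {[]}     [] = []
Linked-reverse {R = R} R-sym {x ∷ xs} l =
  subst (Linked R) (sym (unfold-reverse x xs)) (++⁺ (Linked-reverse R-sym (Linked.tail l)) into-x [-])
  where
  into-x : Connected R (last (reverse xs)) (just x)
  into-x = subst (λ y → Connected R y (just x)) (sym (last-reverse xs))
             (Connected.sym R-sym (Linked.head′ l))

Linked-restrict : ∀ {R : Rel X 0ℓ} {P : X → Set} {xs} →
  Linked R xs → All P xs → Linked (λ x y → R x y × P x × P y) xs
Linked-restrict []      []               = []
Linked-restrict [-]     _                = [-]
Linked-restrict (r ∷ l) (p ∷ ps@(q ∷ _)) = (r , p , q) ∷ Linked-restrict l ps

Linked-revisit : ∀ {S : Rel X 0ℓ} → Transitive S → Irreflexive _≡_ S →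
  ∀ {x} ys {zs} → Linked S (x ∷ ys ++ x ∷ zs) → ⊥
Linked-revisit S-trans S-irrefl ys l with Sx ∷ _ ← Linked⇒AllPairs S-trans l =
  S-irrefl refl (All.head (++⁻ʳ ys Sx))

Linked-wrap : ∀ {R : Rel X 0ℓ} {x y} zs →
  Linked R ((x ∷ y ∷ zs) ∷ʳ x) → Linked R (x ∷ y ∷ zs ++ x ∷ y ∷ [])
Linked-wrap {R = R} {x} {y} zs cycle =
  subst (Linked R) (++-assoc (x ∷ y ∷ zs) [ x ] [ y ]) (++⁺ cycle into-y [-])
  where
  into-y : Connected R (last ((x ∷ y ∷ zs) ∷ʳ x)) (just y)
  into-y = subst (λ w → Connected R w (just y)) (sym (last-∷ʳ (x ∷ y ∷ zs) x))
             (Connected.just (Linked.head cycle))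

NonBacktracking : List X → Set
NonBacktracking (x ∷ y ∷ z ∷ zs) = x ≢ z × NonBacktracking (y ∷ z ∷ zs)
NonBacktracking _                = ⊤

NonBacktracking-++ : ∀ (y z : X) zs {u v} →
  Unique (y ∷ z ∷ zs) → All (u ≢_) (y ∷ z ∷ zs) → All (v ≢_) (z ∷ zs) →
  NonBacktracking (y ∷ z ∷ zs ++ u ∷ v ∷ [])
NonBacktracking-++ y z []       _                      (u≢y ∷ _) (v≢z ∷ _) =
  ≢-sym u≢y , ≢-sym v≢z , tt
NonBacktracking-++ y z (w ∷ zs) ((_ ∷ y≢w ∷ _) ∷ uniq) (_ ∷ u∉)  (_ ∷ v∉)  =
  y≢w , NonBacktracking-++ z w zs uniq u∉ v∉

NonBacktracking-wrap : ∀ (x y z : X) zs →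
  Unique (x ∷ y ∷ z ∷ zs) → NonBacktracking (x ∷ y ∷ z ∷ zs ++ x ∷ y ∷ [])
NonBacktracking-wrap x y z zs (x∉@(_ ∷ x≢z ∷ _) ∷ uniq@(y∉ ∷ _)) =
  x≢z , NonBacktracking-++ y z zs uniq x∉ y∉

LastStep : Rel X 0ℓ → X → X → List X → Set
LastStep S x y []       = S x y
LastStep S x y (z ∷ zs) = LastStep S y z zs

LastStep-++ : ∀ {S : Rel X 0ℓ} x y zs {u v} → S u v → LastStep S x y (zs ++ u ∷ v ∷ [])
LastStep-++ x y []       s = s
LastStep-++ x y (z ∷ zs) s = LastStep-++ y z zs s

Linked⇒LastStep : ∀ {S : Rel X 0ℓ} {x y} zs → Linked S (x ∷ y ∷ zs) → LastStep S x y zs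
Linked⇒LastStep []       (s ∷ [-]) = s
Linked⇒LastStep (_ ∷ zs) (_ ∷ l)   = Linked⇒LastStep zs l

two-colours : ∀ {c₁ c₂ x y z : X} → x ≡ c₁ ⊎ x ≡ c₂ → y ≡ c₁ ⊎ y ≡ c₂ → z ≡ c₁ ⊎ z ≡ c₂ →
  x ≢ z → y ≢ z → x ≡ y
two-colours (inj₁ x≡c) (inj₁ y≡c) _          _   _   = trans x≡c (sym y≡c)
two-colours (inj₂ x≡c) (inj₂ y≡c) _          _   _   = trans x≡c (sym y≡c)
two-colours (inj₁ x≡c) (inj₂ _)   (inj₁ z≡c) x≢z _   = ⊥-elim (x≢z (trans x≡c (sym z≡c)))
two-colours (inj₁ _)   (inj₂ y≡c) (inj₂ z≡c) _   y≢z = ⊥-elim (y≢z (trans y≡c (sym z≡c)))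
two-colours (inj₂ _)   (inj₁ y≡c) (inj₁ z≡c) _   y≢z = ⊥-elim (y≢z (trans y≡c (sym z≡c)))
two-colours (inj₂ x≡c) (inj₁ _)   (inj₂ z≡c) x≢z _   = ⊥-elim (x≢z (trans x≡c (sym z≡c)))

-- Acyclicity from a rank function

module Ranked {X : Set} (R : Rel X 0ℓ) (rank : X → ℕ)
  (rank-differs : ∀ {u v} → R u v → rank u < rank v ⊎ rank v < rank u)
  (lower-neighbour-unique : ∀ {u v w} → R u v → R v w → rank u < rank v → rank w < rank v → u ≡ w)
  where

  Ascends Descends : Rel X 0ℓ
  Ascends  u v = rank u < rank v
  Descends u v = rank v < rank u

  LastStep-asym : ∀ x y zs → LastStep Ascends x y zs → LastStep Descends x y zs → ⊥
  LastStep-asym x y []       = <-asym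
  LastStep-asym x y (z ∷ zs) = LastStep-asym y z zs

  -- Turning downwards after an ascent would give the turning vertex two distinct lower neighbours.
  ascending : ∀ {x y} zs → Linked R (x ∷ y ∷ zs) → NonBacktracking (x ∷ y ∷ zs) →
    Ascends x y → Linked Ascends (x ∷ y ∷ zs)
  ascending []       _                 _          up = up ∷ [-]
  ascending (z ∷ zs) (xy ∷ l@(yz ∷ _)) (x≢z , nb) up with rank-differs yz
  ... | inj₁ up′  = up ∷ ascending zs l nb up′
  ... | inj₂ down = ⊥-elim (x≢z (lower-neighbour-unique xy yz up down))

  descending : ∀ {x y} zs → Linked R (x ∷ y ∷ zs) → NonBacktracking (x ∷ y ∷ zs) →
    LastStep Descends x y zs → Linked Descends (x ∷ y ∷ zs)
  descending []       _ _ down = down ∷ [-]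
  descending {x} {y} (z ∷ zs) l@(xy ∷ l′) nb@(_ , nb′) last-down with rank-differs xy
  ... | inj₁ up   = ⊥-elim (LastStep-asym x y (z ∷ zs) (Linked⇒LastStep _ (ascending _ l nb up)) last-down)
  ... | inj₂ down = down ∷ descending zs l′ nb′ last-down

  no-closed-walk : ∀ {x y} zs → Linked R (x ∷ y ∷ zs ++ x ∷ y ∷ []) →
    NonBacktracking (x ∷ y ∷ zs ++ x ∷ y ∷ []) → ⊥
  no-closed-walk {x} {y} zs walk nb with rank-differs (Linked.head walk)
  ... | inj₁ up   = Linked-revisit <-trans (<-irrefl ∘ cong rank) (y ∷ zs) (ascending _ walk nb up)
  ... | inj₂ down = Linked-revisit (λ p q → <-trans q p) (<-irrefl ∘ cong rank ∘ sym) (y ∷ zs)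
                      (descending _ walk nb (LastStep-++ x y zs down))

  acyclic : ∀ x xs → 3 ≤ length (x ∷ xs) → Unique (x ∷ xs) → Linked R ((x ∷ xs) ∷ʳ x) → ⊥
  acyclic x []           (s≤s ())
  acyclic x (_ ∷ [])     (s≤s (s≤s ()))
  acyclic x (y ∷ z ∷ zs) _ uniq cycle =
    no-closed-walk (z ∷ zs) (Linked-wrap (z ∷ zs) cycle) (NonBacktracking-wrap x y z zs uniq)

-- Injections between finite sets

collision : ∀ {n c} (g : Fin (suc n) → Fin (suc n)) → (∀ x → g x ≢ c) →
  ∃₂ λ x y → x ≢ y × g x ≡ g y
collision {n} g misses
  with x , y , x<y , same ← pigeonhole (n<1+n n) (λ x → punchOut (misses x ∘ sym)) =
  x , y , <⇒≢ x<y , punchOut-injective (misses x ∘ sym) (misses y ∘ sym) same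

injective⇒surjective : ∀ {n} (g : Fin n → Fin n) → Injective _≡_ _≡_ g → ∀ y → ∃ λ x → g x ≡ y
injective⇒surjective {suc n} g g-inj y with any? (λ x → g x ≟ y)
... | yes hit = hit
... | no miss with x , x′ , x≢x′ , same ← collision g (λ x gx≡y → miss (x , gx≡y)) =
  ⊥-elim (x≢x′ (g-inj same))

injective⇒permutation : ∀ {n} (g : Fin n → Fin n) → Injective _≡_ _≡_ g → Permutation′ n
injective⇒permutation g g-inj =
  permutation g (proj₁ ∘ surj) (proj₂ ∘ surj) (λ x → g-inj (proj₂ (surj (g x))))
  where
  surj : ∀ y → ∃ λ x → g x ≡ y
  surj = injective⇒surjective g g-inj

module _ {m : ℕ} {c : Fin (suc m)} {g : Fin m → Fin (suc m)}
  (g-inj : Injective _≡_ _≡_ g) (g-misses : ∀ x → g x ≢ c) where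

  ∷-injective : Injective _≡_ _≡_ (c Vec.∷ g)
  ∷-injective {Fin.zero}  {Fin.zero}  _  = refl
  ∷-injective {Fin.zero}  {Fin.suc y} eq = ⊥-elim (g-misses y (sym eq))
  ∷-injective {Fin.suc x} {Fin.zero}  eq = ⊥-elim (g-misses x eq)
  ∷-injective {Fin.suc x} {Fin.suc y} eq = cong Fin.suc (g-inj eq)

  injection-covers : ∀ y → y ≢ c → ∃ λ x → g x ≡ y
  injection-covers y y≢c with injective⇒surjective (c Vec.∷ g) ∷-injective y
  ... | Fin.zero  , c≡y  = ⊥-elim (y≢c (sym c≡y))
  ... | Fin.suc x , gx≡y = x , gx≡y

  injection-misses-one : ∀ {d} → (∀ x → g x ≢ d) → d ≡ c
  injection-misses-one {d} g-misses-d with d ≟ c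
  ... | yes d≡c = d≡c
  ... | no  d≢c = ⊥-elim (g-misses-d _ (proj₂ (injection-covers d d≢c)))

permutation-between : ∀ {m c} (g g′ : Fin m → Fin (suc m)) →
  Injective _≡_ _≡_ g → Injective _≡_ _≡_ g′ → (∀ x → g x ≢ c) → (∀ x → g′ x ≢ c) →
  Σ (Permutation′ m) λ π → ∀ x → g′ (π ⟨$⟩ʳ x) ≡ g x
permutation-between {m} g g′ g-inj g′-inj g-misses g′-misses =
  injective⇒permutation φ φ-inj , φ-spec
  where
  cover : ∀ x → ∃ λ y → g′ y ≡ g x
  cover x = injection-covers g′-inj g′-misses (g x) (g-misses x)
  φ : Fin m → Fin m
  φ = proj₁ ∘ cover
  φ-spec : ∀ x → g′ (φ x) ≡ g x
  φ-spec = proj₂ ∘ cover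
  φ-inj : Injective _≡_ _≡_ φ
  φ-inj {x} {y} eq = g-inj (trans (sym (φ-spec x)) (trans (cong g′ eq) (φ-spec y)))

punchIn-fromℕ : ∀ {n} (j : Fin n) → punchIn (fromℕ n) j ≡ inject₁ j
punchIn-fromℕ Fin.zero    = refl
punchIn-fromℕ (Fin.suc j) = cong Fin.suc (punchIn-fromℕ j)

liftLast : ∀ {n} → Permutation′ n → Permutation′ (suc n)
liftLast {n} = insert (fromℕ n) (fromℕ n)

liftLast-inject₁ : ∀ {n} (π : Permutation′ n) j → liftLast π ⟨$⟩ʳ inject₁ j ≡ inject₁ (π ⟨$⟩ʳ j)
liftLast-inject₁ {n} π j = begin
  liftLast π ⟨$⟩ʳ inject₁ j            ≡⟨ cong (liftLast π ⟨$⟩ʳ_) (sym (punchIn-fromℕ j)) ⟩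
  liftLast π ⟨$⟩ʳ punchIn (fromℕ n) j  ≡⟨ insert-punchIn (fromℕ n) (fromℕ n) π j ⟩
  punchIn (fromℕ n) (π ⟨$⟩ʳ j)         ≡⟨ punchIn-fromℕ _ ⟩
  inject₁ (π ⟨$⟩ʳ j)                   ∎
  where open ≡-Reasoning

-- level k is the level numbered k when k ≤ n, and the last one otherwise.
level : ∀ {n} → ℕ → Fin (suc n)
level         zero    = Fin.zero
level {zero}  (suc _) = Fin.zero
level {suc n} (suc k) = Fin.suc (level k)

level-toℕ : ∀ {n} (i : Fin (suc n)) → level (toℕ i) ≡ i
level-toℕ         Fin.zero    = refl
level-toℕ {suc n} (Fin.suc i) = cong Fin.suc (level-toℕ i)

toℕ-level : ∀ {n} k → k ≤ n → toℕ (level {n} k) ≡ k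
toℕ-level         zero    _         = refl
toℕ-level {suc n} (suc k) (s≤s k≤n) = cong suc (toℕ-level k k≤n)

module _ {m t : ℕ} where

  Adj-sym : Symmetric (Adj {m} {t})
  Adj-sym = Sum.swap

  a-injectiveʳ : ∀ {i i′ x x′} → a {m} {t} i x ≡ a i′ x′ → x ≡ x′
  a-injectiveʳ refl = refl

  b-injectiveʳ : ∀ {i i′ j j′} → b {m} {t} i j ≡ b i′ j′ → j ≡ j′
  b-injectiveʳ refl = refl

  IsPath-reverse : ∀ {x y ps} → IsPath x y ps → IsPath y x (reverse ps)
  IsPath-reverse {ps = ps} (start , end , uniq , steps) =
    trans (head-reverse ps) end , trans (last-reverse ps) start ,
    Unique-reverse uniq , Linked-reverse Adj-sym steps

  rank : V m t → ℕ
  rank (a i _) = toℕ i + toℕ i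
  rank (b i _) = suc (toℕ i + toℕ i)

  E⇒rank< : ∀ {u v} → E u v → rank u < rank v
  E⇒rank< (full i j j′)        = n<1+n _
  E⇒rank< (link i i′ i′≡1+i j) rewrite i′≡1+i = s≤s (≤-reflexive (sym (+-suc (toℕ i) (toℕ i))))

  Adj⇒rank≢ : ∀ {u v} → Adj u v → rank u < rank v ⊎ rank v < rank u
  Adj⇒rank≢ = Sum.map E⇒rank< E⇒rank<

  rank<⇒≢ : ∀ {u v} → rank u < rank v → u ≢ v
  rank<⇒≢ u<v refl = <-irrefl refl u<v

  Adj-upward : ∀ {u v} → Adj u v → rank u < rank v → E u v
  Adj-upward (inj₁ uv) _   = uv
  Adj-upward (inj₂ vu) u<v = ⊥-elim (<-asym u<v (E⇒rank< vu))

  relabel : (Fin t → Fin m → Fin m) → (Fin t → Fin (suc m) → Fin (suc m)) → V m t → V m t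
  relabel α β (a i j) = a i (α i j)
  relabel α β (b i j) = b i (β i j)

  LinkCompatible : (Fin t → Fin m → Fin m) → (Fin t → Fin (suc m) → Fin (suc m)) → Set
  LinkCompatible α β = ∀ {i i′} → toℕ i′ ≡ suc (toℕ i) → ∀ j → β i (inject₁ j) ≡ inject₁ (α i′ j)

  relabel-preserves-Adj : ∀ {α β} → LinkCompatible α β →
    ∀ {u v} → Adj u v → Adj (relabel α β u) (relabel α β v)
  relabel-preserves-Adj {α} {β} compatible = Sum.map preserves-E preserves-E
    where
    preserves-E : ∀ {u v} → E u v → E (relabel α β u) (relabel α β v)
    preserves-E (full i j j′)        = full i _ _
    preserves-E (link i i′ i′≡1+i j) =
      subst (λ k → E (b i k) (a i′ (α i′ j))) (sym (compatible i′≡1+i j)) (link i i′ i′≡1+i _)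

  relabel-inverse : ∀ {α α′ β β′} → (∀ i j → α′ i (α i j) ≡ j) → (∀ i j → β′ i (β i j) ≡ j) →
    ∀ v → relabel α′ β′ (relabel α β v) ≡ v
  relabel-inverse α′∘α β′∘β (a i j) = cong (a i) (α′∘α i j)
  relabel-inverse α′∘α β′∘β (b i j) = cong (b i) (β′∘β i j)

  module _ (α : Fin t → Permutation′ m) (β : Fin t → Permutation′ (suc m))
    (compatible : LinkCompatible (λ i → α i ⟨$⟩ʳ_) (λ i → β i ⟨$⟩ʳ_)) where

    compatible⁻¹ : LinkCompatible (λ i → α i ⟨$⟩ˡ_) (λ i → β i ⟨$⟩ˡ_)
    compatible⁻¹ {i} {i′} i′≡1+i j = begin
      β i ⟨$⟩ˡ inject₁ j                        ≡⟨ cong (λ k → β i ⟨$⟩ˡ inject₁ k) (sym (inverseʳ (α i′))) ⟩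
      β i ⟨$⟩ˡ inject₁ (α i′ ⟨$⟩ʳ (α i′ ⟨$⟩ˡ j))  ≡⟨ cong (β i ⟨$⟩ˡ_) (sym (compatible i′≡1+i _)) ⟩
      β i ⟨$⟩ˡ (β i ⟨$⟩ʳ inject₁ (α i′ ⟨$⟩ˡ j))  ≡⟨ inverseˡ (β i) ⟩
      inject₁ (α i′ ⟨$⟩ˡ j)                      ∎
      where open ≡-Reasoning

    relabel↔ : V m t ↔ V m t
    relabel↔ =
      mk↔ₛ′ (relabel (λ i → α i ⟨$⟩ʳ_) (λ i → β i ⟨$⟩ʳ_)) (relabel (λ i → α i ⟨$⟩ˡ_) (λ i → β i ⟨$⟩ˡ_))
        (relabel-inverse (λ i _ → inverseʳ (α i)) (λ i _ → inverseʳ (β i)))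
        (relabel-inverse (λ i _ → inverseˡ (α i)) (λ i _ → inverseˡ (β i)))

    relabel-automorphism : IsAutomorphism relabel↔
    relabel-automorphism u v = relabel-preserves-Adj compatible , reflect
      where
      reflect : Adj (Inverse.to relabel↔ u) (Inverse.to relabel↔ v) → Adj u v
      reflect uv = subst₂ Adj (Inverse.inverseʳ relabel↔ refl) (Inverse.inverseʳ relabel↔ refl)
                     (relabel-preserves-Adj compatible⁻¹ uv)

module _ {m t : ℕ} (c₁ c₂ : Fin (suc m)) where

  Adjₕ : Rel (V m t) 0ℓ
  Adjₕ u v = Adj u v × (h u ≡ c₁ ⊎ h u ≡ c₂) × (h v ≡ c₁ ⊎ h v ≡ c₂)

  -- Below a_{i,x} there is only b_{i-1,x}; below b_{i,j} there are only a-vertices, of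
  -- pairwise distinct non-zero colours.
  Adjₕ-lower-neighbour-unique : ∀ {u v w} → Adjₕ u v → Adjₕ v w →
    rank u < rank v → rank w < rank v → u ≡ w
  Adjₕ-lower-neighbour-unique (uv , hu , hv) (vw , _ , hw) u<v w<v
    with Adj-upward uv u<v | Adj-upward (Adj-sym vw) w<v
  ... | link i i′ i′≡1+i x | link i₂ _ i′≡1+i₂ _ =
    cong (λ k → b k (inject₁ x)) (toℕ-injective (ℕ.suc-injective (trans (sym i′≡1+i) i′≡1+i₂)))
  ... | full i x j | full _ y _ =
    cong (a i) (Finₚ.suc-injective (two-colours hu hw hv (λ ()) (λ ())))

h-acyclic : ∀ {m t} → IsAcyclicColouring {m} {t} h
h-acyclic {m} {t} = h-proper , no-bicoloured-cycle
  where
  h-proper : ∀ u v → Adj u v → h u ≢ h v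
  h-proper _ _ (inj₁ (full _ _ _))   ()
  h-proper _ _ (inj₁ (link _ _ _ _)) ()
  h-proper _ _ (inj₂ (full _ _ _))   ()
  h-proper _ _ (inj₂ (link _ _ _ _)) ()

  no-bicoloured-cycle : ∀ vs → IsCycle vs → Bicoloured h vs → ⊥
  no-bicoloured-cycle (v ∷ vs) (long , uniq , cycle) (c₁ , c₂ , coloured) =
    Ranked.acyclic (Adjₕ c₁ c₂) rank (Adj⇒rank≢ ∘ proj₁) (Adjₕ-lower-neighbour-unique c₁ c₂)
      v vs long uniq (Linked-restrict cycle (∷ʳ⁺ coloured (All.head coloured)))

-- Arbitrary acyclic colourings

module AcyclicColouring {m t′ : ℕ} (f : V m (suc t′) → Fin (suc m)) (f-acyclic : IsAcyclicColouring f)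
  where

  private
    Vertex : Set
    Vertex = V m (suc t′)

  proper : ∀ {u v} → Adj u v → f u ≢ f v
  proper = proj₁ f-acyclic _ _

  no-bicoloured-square : ∀ i {x y j j′} → x ≢ y → j ≢ j′ →
    f (a i x) ≡ f (a i y) → f (b i j) ≡ f (b i j′) → ⊥
  no-bicoloured-square i {x} {y} {j} {j′} x≢y j≢j′ ax≡ay bj≡bj′ =
    proj₂ f-acyclic (a i x ∷ b i j ∷ a i y ∷ b i j′ ∷ [])
      ( s≤s (s≤s (s≤s z≤n))
      , ((λ ()) ∷ x≢y ∘ a-injectiveʳ ∷ (λ ()) ∷ []) ∷ ((λ ()) ∷ j≢j′ ∘ b-injectiveʳ ∷ [])
          ∷ ((λ ()) ∷ []) ∷ [] ∷ []
      , inj₁ (full i x j) ∷ inj₂ (full i y j) ∷ inj₁ (full i y j′) ∷ inj₂ (full i x j′) ∷ [-])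
      (f (a i x) , f (b i j) , inj₁ refl ∷ inj₂ refl ∷ inj₁ (sym ax≡ay) ∷ inj₂ (sym bj≡bj′) ∷ [])

  colourₐ : Fin (suc t′) → Fin m → Fin (suc m)
  colourₐ i x = f (a i x)

  -- A repeated a-colour on a level leaves k b-vertices only k - 1 colours.
  colourₐ-injective : ∀ i → Injective _≡_ _≡_ (colourₐ i)
  colourₐ-injective i {x} {y} ax≡ay with x ≟ y
  ... | yes x≡y = x≡y
  ... | no x≢y
    with j , j′ , j≢j′ , bj≡bj′ ← collision (λ j → f (b i j)) (λ j → proper (inj₁ (full i x j)) ∘ sym) =
    ⊥-elim (no-bicoloured-square i x≢y j≢j′ ax≡ay bj≡bj′)

  colour-b-level : ∀ i j j′ → f (b i j) ≡ f (b i j′)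
  colour-b-level i j j′ = injection-misses-one (colourₐ-injective i)
    (λ x → proper (inj₁ (full i x j′))) (λ x → proper (inj₁ (full i x j)))

  colour-b-link : ∀ {i i′} → toℕ i′ ≡ suc (toℕ i) → f (b i Fin.zero) ≡ f (b i′ Fin.zero)
  colour-b-link {i} {i′} i′≡1+i =
    injection-misses-one (colourₐ-injective i′) (λ x → proper (inj₁ (full i′ x Fin.zero))) misses
    where
    misses : ∀ x → colourₐ i′ x ≢ f (b i Fin.zero)
    misses x ax≡b =
      proper (inj₁ (link i i′ i′≡1+i x)) (trans (colour-b-level i (inject₁ x) Fin.zero) (sym ax≡b))

  c₁ : Fin (suc m)
  c₁ = f (b Fin.zero Fin.zero)

  colour-b : ∀ i j → f (b i j) ≡ c₁
  colour-b i j = trans (colour-b-level i j Fin.zero) (colour-b₀ i)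
    where
    colour-b₀ : ∀ i → f (b i Fin.zero) ≡ c₁
    colour-b₀ = <-weakInduction (λ i → f (b i Fin.zero) ≡ c₁) refl
      (λ i ih → trans (sym (colour-b-link (cong suc (sym (toℕ-inject₁ i))))) ih)

  colourₐ-misses-c₁ : ∀ i x → colourₐ i x ≢ c₁
  colourₐ-misses-c₁ i x ax≡c₁ =
    proper (inj₁ (full i x Fin.zero)) (trans ax≡c₁ (sym (colour-b i Fin.zero)))

  colour-permutation : Permutation′ (suc m)
  colour-permutation = injective⇒permutation (c₁ Vec.∷ colourₐ Fin.zero)
    (∷-injective (colourₐ-injective Fin.zero) (colourₐ-misses-c₁ Fin.zero))

  level-matching : ∀ i → Σ (Permutation′ m) λ π → ∀ x → colourₐ i (π ⟨$⟩ʳ x) ≡ colourₐ Fin.zero x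
  level-matching i = permutation-between (colourₐ Fin.zero) (colourₐ i)
    (colourₐ-injective Fin.zero) (colourₐ-injective i) (colourₐ-misses-c₁ Fin.zero) (colourₐ-misses-c₁ i)

  a-permutation : Fin (suc t′) → Permutation′ m
  a-permutation i = proj₁ (level-matching i)

  -- b_{i,j} with j < k must move along with its link partner a_{i+1,j}; the terminal stays put.
  b-permutation : Fin (suc t′) → Permutation′ (suc m)
  b-permutation i = liftLast (a-permutation (level (suc (toℕ i))))

  permutations-compatible : LinkCompatible (λ i → a-permutation i ⟨$⟩ʳ_) (λ i → b-permutation i ⟨$⟩ʳ_)
  permutations-compatible {i} {i′} i′≡1+i j = trans (liftLast-inject₁ _ j)
    (cong (λ k → inject₁ (a-permutation k ⟨$⟩ʳ j)) (trans (cong level (sym i′≡1+i)) (level-toℕ i′)))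

  automorphism : Vertex ↔ Vertex
  automorphism = relabel↔ a-permutation b-permutation permutations-compatible

  automorphism-IsAutomorphism : IsAutomorphism automorphism
  automorphism-IsAutomorphism = relabel-automorphism a-permutation b-permutation permutations-compatible

  f∘automorphism : ∀ v → f (Inverse.to automorphism v) ≡ colour-permutation ⟨$⟩ʳ h v
  f∘automorphism (a i x) = proj₂ (level-matching i) x
  f∘automorphism (b i j) = colour-b i _

  module BicolouredPaths (c₂ : Fin (suc m)) (c₂≢c₁ : c₂ ≢ c₁) where

    Coloured : Vertex → Set
    Coloured v = f v ≡ c₁ ⊎ f v ≡ c₂

    BicolouredPath : Vertex → Vertex → Set
    BicolouredPath x y = Σ (List Vertex) λ ps → IsPath x y ps × All Coloured ps

    p : Fin (suc t′) → Fin m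
    p i = proj₁ (injection-covers (colourₐ-injective i) (colourₐ-misses-c₁ i) c₂ c₂≢c₁)

    p-colour : ∀ i → colourₐ i (p i) ≡ c₂
    p-colour i = proj₂ (injection-covers (colourₐ-injective i) (colourₐ-misses-c₁ i) c₂ c₂≢c₁)

    terminalAt : ℕ → Vertex
    terminalAt ℓ = terminal (level ℓ)

    A B : ℕ → Vertex
    A ℓ = a (level ℓ) (p (level ℓ))
    B ℓ = b (level ℓ) (inject₁ (p (level (suc ℓ))))

    climb : ℕ → ℕ → List Vertex
    climb ℓ zero    = terminalAt ℓ ∷ []
    climb ℓ (suc n) = B ℓ ∷ A (suc ℓ) ∷ climb (suc ℓ) n

    climb-E : ∀ ℓ n → ℓ + n ≤ t′ → Linked E (A ℓ ∷ climb ℓ n)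
    climb-E ℓ zero    _     = full _ _ _ ∷ [-]
    climb-E ℓ (suc n) ℓ+n≤t =
      full _ _ _ ∷ link (level ℓ) (level (suc ℓ)) next _ ∷ climb-E (suc ℓ) n 1+ℓ+n≤t
      where
      1+ℓ+n≤t : suc ℓ + n ≤ t′
      1+ℓ+n≤t = subst (_≤ t′) (+-suc ℓ n) ℓ+n≤t
      next : toℕ (level {t′} (suc ℓ)) ≡ suc (toℕ (level {t′} ℓ))
      next = trans (toℕ-level (suc ℓ) (≤-trans (m≤m+n (suc ℓ) n) 1+ℓ+n≤t))
                   (cong suc (sym (toℕ-level ℓ (≤-trans (m≤m+n ℓ (suc n)) ℓ+n≤t))))

    last-climb : ∀ ℓ n → last (A ℓ ∷ climb ℓ n) ≡ just (terminalAt (ℓ + n))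
    last-climb ℓ zero    = cong (just ∘ terminalAt) (sym (+-identityʳ ℓ))
    last-climb ℓ (suc n) = trans (last-climb (suc ℓ) n) (cong (just ∘ terminalAt) (sym (+-suc ℓ n)))

    climb-coloured : ∀ ℓ n → All Coloured (A ℓ ∷ climb ℓ n)
    climb-coloured ℓ zero    = inj₂ (p-colour _) ∷ inj₁ (colour-b _ _) ∷ []
    climb-coloured ℓ (suc n) = inj₂ (p-colour _) ∷ inj₁ (colour-b _ _) ∷ climb-coloured (suc ℓ) n

    path : ℕ → ℕ → List Vertex
    path ℓ zero    = terminalAt ℓ ∷ []
    path ℓ (suc n) = terminalAt ℓ ∷ A ℓ ∷ climb ℓ (suc n)

    path-coloured : ∀ ℓ n → All Coloured (path ℓ n)
    path-coloured ℓ zero    = inj₁ (colour-b _ _) ∷ []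
    path-coloured ℓ (suc n) = inj₁ (colour-b _ _) ∷ climb-coloured ℓ (suc n)

    path-IsPath : ∀ ℓ n → ℓ + n ≤ t′ → IsPath (terminalAt ℓ) (terminalAt (ℓ + n)) (path ℓ n)
    path-IsPath ℓ zero    _     = refl , cong (just ∘ terminalAt) (sym (+-identityʳ ℓ)) , [] ∷ [] , [-]
    path-IsPath ℓ (suc n) ℓ+n≤t =
      refl , last-climb ℓ (suc n) , uniq , inj₂ (full _ _ _) ∷ Linked.map inj₁ steps
      where
      steps : Linked E (A ℓ ∷ climb ℓ (suc n))
      steps = climb-E ℓ (suc n) ℓ+n≤t
      -- After the first vertex the path climbs strictly in rank, and the first vertex has the rank of B ℓ.
      uniq : Unique (path ℓ (suc n))
      uniq with ranks@(_ ∷ above-B ∷ _) ← Linked⇒AllPairs <-trans (Linked.map E⇒rank< steps) =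
        ((λ ()) ∷ fromℕ≢inject₁ ∘ b-injectiveʳ ∷ All.map rank<⇒≢ above-B) ∷ AllPairs.map rank<⇒≢ ranks

    upward-path : ∀ I I′ → toℕ I ≤ toℕ I′ → BicolouredPath (terminal I) (terminal I′)
    upward-path I I′ I≤I′ with n , I+n≡I′ ← ≤⇒∃+ I≤I′ =
      path (toℕ I) n ,
      subst₂ (λ x y → IsPath (terminal x) (terminal y) (path (toℕ I) n))
        (level-toℕ I) (trans (cong level I+n≡I′) (level-toℕ I′))
        (path-IsPath (toℕ I) n (subst (_≤ t′) (sym I+n≡I′) (toℕ≤pred I′))) ,
      path-coloured (toℕ I) n

    bicoloured-path : ∀ I I′ → BicolouredPath (terminal I) (terminal I′)
    bicoloured-path I I′ with ≤-total (toℕ I) (toℕ I′)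
    ... | inj₁ I≤I′ = upward-path I I′ I≤I′
    ... | inj₂ I′≤I with ps , is-path , coloured ← upward-path I′ I I′≤I =
      reverse ps , IsPath-reverse is-path , All-reverse coloured

lemma1 : (m t : ℕ) → 2 ≤ m → 1 ≤ t →
    IsAcyclicColouring {m} {t} h
    × (∀ (f : V m t → Fin (suc m)) → IsAcyclicColouring f →
        Σ (Permutation′ (suc m)) λ σ → Σ (V m t ↔ V m t) λ ψ →
          IsAutomorphism ψ × (∀ v → f (Inverse.to ψ v) ≡ σ ⟨$⟩ʳ h v))
    × (∀ (f : V m t → Fin (suc m)) → IsAcyclicColouring f →
        Σ (Fin (suc m)) λ c₁ →
          (∀ i → f (terminal i) ≡ c₁)
          × (∀ (c₂ : Fin (suc m)) → c₂ ≢ c₁ → ∀ (i i' : Fin t) →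
              Σ (List (V m t)) λ ps → IsPath (terminal i) (terminal i') ps
                × All (λ v → f v ≡ c₁ ⊎ f v ≡ c₂) ps))
lemma1 m (suc t′) _ _ =
  h-acyclic ,
  (λ f f-acyclic → let open AcyclicColouring f f-acyclic in
    colour-permutation , automorphism , automorphism-IsAutomorphism , f∘automorphism) ,
  (λ f f-acyclic → let open AcyclicColouring f f-acyclic in
    c₁ , (λ i → colour-b i _) , BicolouredPaths.bicoloured-path)
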